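{- Let $k$ be a positive integer. A graph $G=(V,E)$ is a $k$-trail if and only if the vector $\lambda\in\mathbb{Z}^V_{>0}$ defined by $\lambda(v)=\left\lceil \frac{\deg_G(v)}{k}\right\rceil$ for all $v\in V$ is a feasible multiplicity vector for $G$.
   Context: All graphs are undirected, connected, may have loops and parallel edges, and have at least $2$ vertices. A graph $G=(V,E)$ is the homomorphic image of a graph $H=(W,F)$ by an onto function $\phi:W\rightarrow V$ if for any two vertices $u,v\in V$ (possibly $u=v$), the number of edges of $G$ between $u$ and $v$ equals the number of edges of $H$ whose endpoints are mapped by $\phi$ to $\{u,v\}$. $G$ is a $k$-trail if it is the homomorphic image of a connected graph of maximum degree at most $k$. A vector $\lambda\in\mathbb{Z}^V_{>0}$ is a feasible multiplicity vector for $G$ if there is a connected graph $H=(W,F)$ and an onto function $\phi:W\rightarrow V$ such that $G$ is the homomorphic image of $H$ by $\phi$ and $|\phi^{ -1}(v)|=\lambda(v)$ for all $v\in V$. $\deg_G(v)$ is the degree of $v$ in $G$. -}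

module Defs where

open import Data.Nat using (ℕ; zero; suc; _+_; _∸_; _≤_; NonZero)
open import Data.Nat.DivMod using (_/_)
open import Data.Fin using (Fin; zero; suc; _≟_)
open import Data.Product using (_×_; _,_; proj₁; proj₂; Σ; ∃; ∃-syntax)
open import Relation.Binary.PropositionalEquality using (_≡_)
open import Relation.Nullary.Decidable using (⌊_⌋; _×-dec_; _⊎-dec_)

sumFin : (n : ℕ) → (Fin n → ℕ) → ℕ
sumFin zero    f = 0
sumFin (suc n) f = f zero + sumFin n (λ i → f (suc i))

ind : ∀ {p} {P : Set p} → Relation.Nullary.Decidable.Dec P → ℕ
ind d = if ⌊ d ⌋ then 1 else 0
  where open import Data.Bool using (if_then_else_)

-- A finite multigraph (loops and parallel edges allowed):
-- vertices Fin nV, edges Fin nE, each edge has an (unordered) pair of endpoints.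
record Graph : Set where
  field
    nV   : ℕ
    nE   : ℕ
    ends : Fin nE → Fin nV × Fin nV
open Graph public

edgesBetween : (G : Graph) → Fin (nV G) → Fin (nV G) → ℕ
edgesBetween G u v = sumFin (nE G) λ e →
  let a = proj₁ (ends G e) ; b = proj₂ (ends G e) in
  ind (((a ≟ u) ×-dec (b ≟ v)) ⊎-dec ((a ≟ v) ×-dec (b ≟ u)))

-- Degree: each edge contributes the number of its endpoints equal to v
-- (so a loop counts twice).
deg : (G : Graph) → Fin (nV G) → ℕ
deg G v = sumFin (nE G) λ e →
  ind (proj₁ (ends G e) ≟ v) + ind (proj₂ (ends G e) ≟ v)

data Reach (G : Graph) (u : Fin (nV G)) : Fin (nV G) → Set where
  here : Reach G u u
  fwd  : (e : Fin (nE G)) → Reach G u (proj₁ (ends G e)) →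
         Reach G u (proj₂ (ends G e))
  bwd  : (e : Fin (nE G)) → Reach G u (proj₂ (ends G e)) →
         Reach G u (proj₁ (ends G e))

Connected : Graph → Set
Connected G = ∀ u v → Reach G u v

MaxDegAtMost : ℕ → Graph → Set
MaxDegAtMost k H = ∀ w → deg H w ≤ k

Onto : ∀ {m n} → (Fin m → Fin n) → Set
Onto φ = ∀ v → ∃[ w ] φ w ≡ v

HomImage : (G H : Graph) → (Fin (nV H) → Fin (nV G)) → Set
HomImage G H φ =
  Onto φ ×
  (∀ u v → edgesBetween G u v ≡
     (sumFin (nE H) λ f →
        let a = φ (proj₁ (ends H f)) ; b = φ (proj₂ (ends H f)) in
        ind (((a ≟ u) ×-dec (b ≟ v)) ⊎-dec ((a ≟ v) ×-dec (b ≟ u)))))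

KTrail : ℕ → Graph → Set
KTrail k G = ∃[ H ] Connected H × MaxDegAtMost k H ×
             ∃[ φ ] HomImage G H φ

preimageSize : ∀ {m n} → (Fin m → Fin n) → Fin n → ℕ
preimageSize {m} φ v = sumFin m λ w → ind (φ w ≟ v)

-- λ is a feasible multiplicity vector for G (λ positive is part of the notion).
Feasible : (G : Graph) → (Fin (nV G) → ℕ) → Set
Feasible G λv = (∀ v → 1 ≤ λv v) ×
  ∃[ H ] Connected H × ∃[ φ ] HomImage G H φ × (∀ v → preimageSize φ v ≡ λv v)

ceilDiv : (d k : ℕ) → .{{NonZero k}} → ℕ
ceilDiv d k = (d + (k ∸ 1)) / k

module Submission where

-- Both directions rest on the fibre formula (deg-hom): if G is the homomorphic
-- image of H by φ, then deg_G(v) is the total degree in H of the fibre φ⁻¹(v).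
-- It follows from a handshake identity at each edge, which recovers degrees
-- from edge multiplicities, the data a homomorphic image preserves.
--
-- (⇒) A cover of maximum degree k has |φ⁻¹(v)| ≥ deg(v)/k, hence ≥ λ(v).
--     Collapsing two vertices of an oversized fibre keeps the cover connected,
--     so the fibres can be cut down to exactly λ (shrink-fibres).
-- (⇐) A connected cover with |φ⁻¹(v)| = λ(v) has deg(v) ≤ k·|φ⁻¹(v)|, so a
--     fibre containing a vertex of degree above k also contains one below k.
--     Moving one end of a suitable edge from the former to the latter keeps
--     the cover connected and lowers the total excess Σ (deg − k)⁺
--     (rebalance); iterating reaches maximum degree at most k (balance).

open import Defs
open import Data.Nat using (ℕ; zero; suc; _+_; _*_; _∸_; _≤_; _<_; z≤n; s≤s; z<s; s≤s⁻¹; NonZero; >-nonZero⁻¹; _<?_)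
open import Data.Nat.Properties hiding (_≟_)
open import Data.Nat.DivMod using (_/_; _%_; m<n*o⇒m/o<n; m≡m%n+[m/n]*n; m%n<n; m≥n⇒m/n>0)
open import Data.Fin using (Fin; zero; suc; _≟_; punchIn; punchOut)
open import Data.Fin.Properties using (punchInᵢ≢i; punchOut-cong; punchOut-punchIn; punchIn-punchOut; any?)
open import Data.Product using (∃-syntax; _×_; _,_; proj₁; proj₂)
open import Data.Sum using (_⊎_; inj₁; inj₂; [_,_])
open import Data.Empty using (⊥-elim)
open import Function using (_∘_)
open import Function.Bundles using (_⇔_; mk⇔)
open import Relation.Nullary using (Dec; yes; no; ¬_)
open import Relation.Nullary.Decidable using (_×-dec_; _⊎-dec_)
open import Relation.Binary.PropositionalEquality
  using (_≡_; _≢_; refl; sym; trans; cong; cong₂; subst; module ≡-Reasoning)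
open import Algebra.Properties.CommutativeSemigroup +-commutativeSemigroup
  using (xy∙z≈zy∙x; xy∙z≈xz∙y; x∙yz≈xz∙y)
import Algebra.Properties.Semiring.Sum as SemiringSum

ceilDiv-least : ∀ d k .{{_ : NonZero k}} s → d ≤ k * s → ceilDiv d k ≤ s
ceilDiv-least d (suc j) s d≤ks = <⇒≤pred (m<n*o⇒m/o<n {d + j} {suc s} {suc j} bound)
  where
  bound : d + j < suc s * suc j
  bound = begin-strict
    d + j              ≤⟨ +-monoˡ-≤ j d≤ks ⟩
    suc j * s + j      <⟨ +-monoʳ-< (suc j * s) (n<1+n j) ⟩
    suc j * s + suc j  ≡⟨ +-comm (suc j * s) (suc j) ⟩
    suc j + suc j * s  ≡⟨ cong (suc j +_) (*-comm (suc j) s) ⟩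
    suc s * suc j      ∎
    where open ≤-Reasoning

ceilDiv-covers : ∀ d k .{{_ : NonZero k}} → d ≤ k * ceilDiv d k
ceilDiv-covers d (suc j) = +-cancelʳ-≤ j d _ bound
  where
  q : ℕ
  q = (d + j) / suc j
  bound : d + j ≤ suc j * q + j
  bound = begin
    d + j                        ≡⟨ m≡m%n+[m/n]*n (d + j) (suc j) ⟩
    (d + j) % suc j + q * suc j  ≤⟨ +-monoˡ-≤ (q * suc j) (<⇒≤pred (m%n<n (d + j) (suc j))) ⟩
    j + q * suc j                ≡⟨ +-comm j _ ⟩
    q * suc j + j                ≡⟨ cong (_+ j) (*-comm q (suc j)) ⟩
    suc j * q + j                ∎
    where open ≤-Reasoning

ceilDiv-pos : ∀ d k .{{_ : NonZero k}} → 1 ≤ d → 1 ≤ ceilDiv d k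
ceilDiv-pos (suc d) (suc j) _ = m≥n⇒m/n>0 {suc d + j} {suc j} (s≤s (m≤n+m j d))

-- Finite sums.  'sumFin n f' is, clause for clause, the library's 'sum f'
-- over the semiring ℕ; the algebraic laws are imported through this bridge,
-- the order-theoretic ones are proved by induction.

module ∑ = SemiringSum +-*-semiring

sumFin≡sum : ∀ n (f : Fin n → ℕ) → sumFin n f ≡ ∑.sum f
sumFin≡sum zero    f = refl
sumFin≡sum (suc n) f = cong (f zero +_) (sumFin≡sum n (f ∘ suc))

sum-cong : ∀ n {f g : Fin n → ℕ} → (∀ i → f i ≡ g i) → sumFin n f ≡ sumFin n g
sum-cong n {f} {g} f≗g = begin
  sumFin n f  ≡⟨ sumFin≡sum n f ⟩
  ∑.sum f     ≡⟨ ∑.sum-cong-≗ f≗g ⟩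
  ∑.sum g     ≡⟨ sumFin≡sum n g ⟨
  sumFin n g  ∎
  where open ≡-Reasoning

sum-zero : ∀ n {f : Fin n → ℕ} → (∀ i → f i ≡ 0) → sumFin n f ≡ 0
sum-zero n f≗0 = trans (sum-cong n f≗0) (trans (sumFin≡sum n _) (∑.sum-replicate-zero n))

sum-+ : ∀ n (f g : Fin n → ℕ) →
        sumFin n (λ i → f i + g i) ≡ sumFin n f + sumFin n g
sum-+ n f g = begin
  sumFin n (λ i → f i + g i)  ≡⟨ sumFin≡sum n _ ⟩
  ∑.sum (λ i → f i + g i)     ≡⟨ ∑.∑-distrib-+ f g ⟩
  ∑.sum f + ∑.sum g           ≡⟨ cong₂ _+_ (sumFin≡sum n f) (sumFin≡sum n g) ⟨
  sumFin n f + sumFin n g     ∎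
  where open ≡-Reasoning

sum-*ˡ : ∀ n k (f : Fin n → ℕ) → sumFin n (λ i → k * f i) ≡ k * sumFin n f
sum-*ˡ n k f = begin
  sumFin n (λ i → k * f i)  ≡⟨ sumFin≡sum n _ ⟩
  ∑.sum (λ i → k * f i)     ≡⟨ ∑.*-distribˡ-sum k f ⟨
  k * ∑.sum f               ≡⟨ cong (k *_) (sumFin≡sum n f) ⟨
  k * sumFin n f            ∎
  where open ≡-Reasoning

sum-swap : ∀ n m (f : Fin n → Fin m → ℕ) →
           sumFin n (λ i → sumFin m (f i)) ≡ sumFin m (λ j → sumFin n (λ i → f i j))
sum-swap n m f = begin
  sumFin n (λ i → sumFin m (f i))            ≡⟨ double n m f ⟩
  ∑.sum (λ i → ∑.sum (f i))                  ≡⟨ ∑.∑-comm f ⟩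
  ∑.sum (λ j → ∑.sum (λ i → f i j))          ≡⟨ double m n (λ j i → f i j) ⟨
  sumFin m (λ j → sumFin n (λ i → f i j))    ∎
  where
  open ≡-Reasoning
  double : ∀ n m (g : Fin n → Fin m → ℕ) →
           sumFin n (λ i → sumFin m (g i)) ≡ ∑.sum (λ i → ∑.sum (g i))
  double n m g = trans (sum-cong n (λ i → sumFin≡sum m (g i))) (sumFin≡sum n _)

sum-pivot : ∀ n (f : Fin (suc n) → ℕ) c →
            sumFin (suc n) f ≡ f c + sumFin n (f ∘ punchIn c)
sum-pivot n f c = begin
  sumFin (suc n) f              ≡⟨ sumFin≡sum (suc n) f ⟩
  ∑.sum f                       ≡⟨ ∑.sum-remove {i = c} f ⟩
  f c + ∑.sum (f ∘ punchIn c)   ≡⟨ cong (f c +_) (sumFin≡sum n _) ⟨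
  f c + sumFin n (f ∘ punchIn c) ∎
  where open ≡-Reasoning

sum-update : ∀ n (f f′ : Fin n → ℕ) e → (∀ i → i ≢ e → f′ i ≡ f i) →
             sumFin n f′ + f e ≡ sumFin n f + f′ e
sum-update (suc n) f f′ e agree = begin
  sumFin (suc n) f′ + f e       ≡⟨ cong (_+ f e) (sum-pivot n f′ e) ⟩
  f′ e + sumFin n (f′ ∘ punchIn e) + f e
    ≡⟨ cong (λ s → f′ e + s + f e) (sum-cong n (λ j → agree (punchIn e j) (punchInᵢ≢i e j))) ⟩
  f′ e + rest + f e             ≡⟨ xy∙z≈zy∙x (f′ e) rest (f e) ⟩
  f e + rest + f′ e             ≡⟨ cong (_+ f′ e) (sum-pivot n f e) ⟨
  sumFin (suc n) f + f′ e       ∎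
  where
  open ≡-Reasoning
  rest : ℕ
  rest = sumFin n (f ∘ punchIn e)

sum-mono : ∀ n {f g : Fin n → ℕ} → (∀ i → f i ≤ g i) → sumFin n f ≤ sumFin n g
sum-mono zero    f≤g = z≤n
sum-mono (suc n) f≤g = +-mono-≤ (f≤g zero) (sum-mono n (f≤g ∘ suc))

sum-strict : ∀ n {f g : Fin n → ℕ} → (∀ i → f i ≤ g i) → ∀ c → f c < g c →
             sumFin n f < sumFin n g
sum-strict (suc n) {f} {g} f≤g c fc<gc
  rewrite sum-pivot n f c | sum-pivot n g c =
  +-mono-<-≤ fc<gc (sum-mono n (f≤g ∘ punchIn c))

term≤sum : ∀ n (f : Fin n → ℕ) c → f c ≤ sumFin n f
term≤sum (suc n) f c rewrite sum-pivot n f c = m≤m+n (f c) _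

sum-pos : ∀ n (f : Fin n → ℕ) → 0 < sumFin n f → ∃[ i ] 0 < f i
sum-pos (suc n) f pos with f zero in eq
... | suc _ = zero , subst (0 <_) (sym eq) z<s
... | zero  = let (i , fi>0) = sum-pos n (f ∘ suc) pos in suc i , fi>0

sum-other : ∀ n (f : Fin n → ℕ) c → f c < sumFin n f → ∃[ i ] i ≢ c × 0 < f i
sum-other (suc n) f c fc<sum rewrite sum-pivot n f c =
  let rest = sumFin n (f ∘ punchIn c)
      rest>0 = +-cancelˡ-< (f c) 0 rest (subst (_< f c + rest) (sym (+-identityʳ (f c))) fc<sum)
      (j , fj>0) = sum-pos n (f ∘ punchIn c) rest>0
  in punchIn c j , punchInᵢ≢i c j , fj>0

ind-yes : ∀ {P : Set} (d : Dec P) → P → ind d ≡ 1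
ind-yes (yes _) _ = refl
ind-yes (no ¬p) p = ⊥-elim (¬p p)

ind-no : ∀ {P : Set} (d : Dec P) → ¬ P → ind d ≡ 0
ind-no (yes p) ¬p = ⊥-elim (¬p p)
ind-no (no _)  _  = refl

ind-pos : ∀ {P : Set} (d : Dec P) → 0 < ind d → P
ind-pos (yes p) _ = p

ind-iff : ∀ {P Q : Set} (d : Dec P) (d′ : Dec Q) → (P → Q) → (Q → P) → ind d ≡ ind d′
ind-iff (yes p) d′ to from = sym (ind-yes d′ (to p))
ind-iff (no ¬p) d′ to from = sym (ind-no d′ (¬p ∘ from))

sum-delta : ∀ n (f : Fin n → ℕ) c → sumFin n (λ y → f y * ind (c ≟ y)) ≡ f c
sum-delta (suc n) f c = begin
  sumFin (suc n) (λ y → f y * ind (c ≟ y))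
    ≡⟨ sum-pivot n (λ y → f y * ind (c ≟ y)) c ⟩
  f c * ind (c ≟ c) + sumFin n (λ j → f (punchIn c j) * ind (c ≟ punchIn c j))
    ≡⟨ cong₂ _+_ (cong (f c *_) (ind-yes (c ≟ c) refl)) (sum-zero n off-c) ⟩
  f c * 1 + 0
    ≡⟨ trans (+-identityʳ _) (*-identityʳ _) ⟩
  f c
    ∎
  where
  open ≡-Reasoning
  off-c : ∀ j → f (punchIn c j) * ind (c ≟ punchIn c j) ≡ 0
  off-c j = trans (cong (f (punchIn c j) *_) (ind-no (c ≟ punchIn c j) (punchInᵢ≢i c j ∘ sym)))
                  (*-zeroʳ (f (punchIn c j)))

sum-indicator : ∀ n (c : Fin n) → sumFin n (λ y → ind (c ≟ y)) ≡ 1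
sum-indicator n c = trans (sum-cong n (λ y → sym (*-identityˡ (ind (c ≟ y))))) (sum-delta n (λ _ → 1) c)

reach-trans : ∀ {G u v x} → Reach G u v → Reach G v x → Reach G u x
reach-trans r here      = r
reach-trans r (fwd e s) = fwd e (reach-trans r s)
reach-trans r (bwd e s) = bwd e (reach-trans r s)

reach-sym : ∀ {G u v} → Reach G u v → Reach G v u
reach-sym here      = here
reach-sym (fwd e r) = reach-trans (bwd e here) (reach-sym r)
reach-sym (bwd e r) = reach-trans (fwd e here) (reach-sym r)

step-fwd : ∀ {G s} e {a b} → ends G e ≡ (a , b) → Reach G s a → Reach G s b
step-fwd {G} {s} e eq r =
  subst (Reach G s) (cong proj₂ eq) (fwd e (subst (Reach G s) (sym (cong proj₁ eq)) r))

step-bwd : ∀ {G s} e {a b} → ends G e ≡ (a , b) → Reach G s b → Reach G s a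
step-bwd {G} {s} e eq r =
  subst (Reach G s) (cong proj₁ eq) (bwd e (subst (Reach G s) (sym (cong proj₂ eq)) r))

-- Summed over the edges of G these are
-- definitionally 'deg G v' and 'edgesBetween G u v'.

incidence : ∀ {n} → Fin n × Fin n → Fin n → ℕ
incidence p v = ind (proj₁ p ≟ v) + ind (proj₂ p ≟ v)

joins : ∀ {n} → Fin n × Fin n → Fin n → Fin n → ℕ
joins p u v = ind (((proj₁ p ≟ u) ×-dec (proj₂ p ≟ v)) ⊎-dec ((proj₁ p ≟ v) ×-dec (proj₂ p ≟ u)))

EndAt : ∀ {n} → Fin n × Fin n → Fin n → Set
EndAt p w = proj₁ p ≡ w ⊎ proj₂ p ≡ w

incidence-pos : ∀ {n} {v : Fin n} p → EndAt p v → 1 ≤ incidence p v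
incidence-pos {v = v} p (inj₁ a≡v) rewrite ind-yes (proj₁ p ≟ v) a≡v = s≤s z≤n
incidence-pos {v = v} p (inj₂ b≡v) rewrite ind-yes (proj₂ p ≟ v) b≡v = m≤n+m 1 _

incidence-pos⁻¹ : ∀ {n} {v : Fin n} p → 0 < incidence p v → EndAt p v
incidence-pos⁻¹ {v = v} p pos with proj₁ p ≟ v | proj₂ p ≟ v
... | yes a≡v | _       = inj₁ a≡v
... | no  _   | yes b≡v = inj₂ b≡v

last-edge : ∀ {G u v} → Reach G u v → u ≢ v →
            ∃[ e ] EndAt (ends G e) v
last-edge here      u≢v = ⊥-elim (u≢v refl)
last-edge (fwd e _) _   = e , inj₂ refl
last-edge (bwd e _) _   = e , inj₁ refl

another-vertex : ∀ {N} → 2 ≤ N → (v : Fin N) → ∃[ u ] u ≢ v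
another-vertex {suc (suc _)} _ zero    = suc zero , λ ()
another-vertex {suc (suc _)} _ (suc _) = zero , λ ()
another-vertex {suc zero}    (s≤s ()) _

deg-pos : ∀ G → 2 ≤ nV G → Connected G → ∀ v → 1 ≤ deg G v
deg-pos G two conn v =
  let (u , u≢v) = another-vertex two v
      (e , at-v) = last-edge (conn u v) u≢v
  in ≤-trans (incidence-pos (ends G e) at-v) (term≤sum (nE G) (λ f → incidence (ends G f) v) e)

-- Handshake at an end a ≡ v: the only neighbour of v is b, and the edge is a
-- loop at v iff b ≡ v.
handshake-at-end : ∀ n (a b v : Fin n) → a ≡ v →
  sumFin n (λ u → joins (a , b) v u) + joins (a , b) v v ≡ incidence (a , b) v
handshake-at-end n a b v a≡v = begin
  sumFin n (λ u → joins (a , b) v u) + joins (a , b) v v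
    ≡⟨ cong₂ _+_ (trans (sum-cong n (λ u → ind-iff _ (b ≟ u) (to u) (from u))) (sum-indicator n b))
                 (ind-iff _ (b ≟ v) proj₂-either (λ b≡v → inj₁ (a≡v , b≡v))) ⟩
  1 + ind (b ≟ v)
    ≡⟨ cong (_+ ind (b ≟ v)) (ind-yes (a ≟ v) a≡v) ⟨
  incidence (a , b) v
    ∎
  where
  open ≡-Reasoning
  to : ∀ u → (a ≡ v × b ≡ u) ⊎ (a ≡ u × b ≡ v) → b ≡ u
  to u (inj₁ (_ , b≡u))   = b≡u
  to u (inj₂ (a≡u , b≡v)) = trans b≡v (trans (sym a≡v) a≡u)
  from : ∀ u → b ≡ u → (a ≡ v × b ≡ u) ⊎ (a ≡ u × b ≡ v)
  from u b≡u = inj₁ (a≡v , b≡u)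
  proj₂-either : (a ≡ v × b ≡ v) ⊎ (a ≡ v × b ≡ v) → b ≡ v
  proj₂-either (inj₁ (_ , b≡v)) = b≡v
  proj₂-either (inj₂ (_ , b≡v)) = b≡v

handshake-away : ∀ n (a b v : Fin n) → a ≢ v → b ≢ v →
  sumFin n (λ u → joins (a , b) v u) + joins (a , b) v v ≡ incidence (a , b) v
handshake-away n a b v a≢v b≢v = begin
  sumFin n (λ u → joins (a , b) v u) + joins (a , b) v v
    ≡⟨ cong₂ _+_ (sum-zero n (λ u → ind-no _ (away u))) (ind-no _ (away v)) ⟩
  0 + 0
    ≡⟨ cong₂ _+_ (ind-no (a ≟ v) a≢v) (ind-no (b ≟ v) b≢v) ⟨
  incidence (a , b) v
    ∎
  where
  open ≡-Reasoning
  away : ∀ u → ¬ ((a ≡ v × b ≡ u) ⊎ (a ≡ u × b ≡ v))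
  away u (inj₁ (a≡v , _)) = a≢v a≡v
  away u (inj₂ (_ , b≡v)) = b≢v b≡v

joins-swap : ∀ {n} (a b u v : Fin n) → joins (a , b) u v ≡ joins (b , a) u v
joins-swap a b u v = ind-iff _ _ flip flip
  where
  flip : ∀ {x y} → (x ≡ u × y ≡ v) ⊎ (x ≡ v × y ≡ u) → (y ≡ u × x ≡ v) ⊎ (y ≡ v × x ≡ u)
  flip (inj₁ (p , q)) = inj₂ (q , p)
  flip (inj₂ (p , q)) = inj₁ (q , p)

joins-handshake : ∀ n (a b v : Fin n) →
  sumFin n (λ u → joins (a , b) v u) + joins (a , b) v v ≡ incidence (a , b) v
joins-handshake n a b v = by-cases (a ≟ v) (b ≟ v)
  where
  open ≡-Reasoning
  by-cases : Dec (a ≡ v) → Dec (b ≡ v) →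
    sumFin n (λ u → joins (a , b) v u) + joins (a , b) v v ≡ incidence (a , b) v
  by-cases (yes a≡v) _         = handshake-at-end n a b v a≡v
  by-cases (no  a≢v) (no  b≢v) = handshake-away n a b v a≢v b≢v
  by-cases (no  _)   (yes b≡v) = begin
    sumFin n (λ u → joins (a , b) v u) + joins (a , b) v v
      ≡⟨ cong₂ _+_ (sum-cong n (joins-swap a b v)) (joins-swap a b v v) ⟩
    sumFin n (λ u → joins (b , a) v u) + joins (b , a) v v
      ≡⟨ handshake-at-end n b a v b≡v ⟩
    incidence (b , a) v
      ≡⟨ +-comm (ind (b ≟ v)) (ind (a ≟ v)) ⟩
    incidence (a , b) v
      ∎

deg-from-multiplicities : ∀ G v →
  deg G v ≡ sumFin (nV G) (λ u → edgesBetween G v u) + edgesBetween G v v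
deg-from-multiplicities G v = begin
  deg G v
    ≡⟨ sum-cong (nE G) (λ e → joins-handshake (nV G) (proj₁ (ends G e)) (proj₂ (ends G e)) v) ⟨
  sumFin (nE G) (λ e → sumFin (nV G) (λ u → joins (ends G e) v u) + joins (ends G e) v v)
    ≡⟨ sum-+ (nE G) _ _ ⟩
  sumFin (nE G) (λ e → sumFin (nV G) (λ u → joins (ends G e) v u)) + edgesBetween G v v
    ≡⟨ cong (_+ edgesBetween G v v) (sum-swap (nE G) (nV G) _) ⟩
  sumFin (nV G) (λ u → edgesBetween G v u) + edgesBetween G v v
    ∎
  where open ≡-Reasoning

mkGraph : (n m : ℕ) → (Fin m → Fin n × Fin n) → Graph
mkGraph n m p = record { nV = n ; nE = m ; ends = p }

image : (H : Graph) {n : ℕ} → (Fin (nV H) → Fin n) → Graph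
image H {n} σ = mkGraph n (nE H) (λ f → σ (proj₁ (ends H f)) , σ (proj₂ (ends H f)))

deg-image : ∀ H {n} (σ : Fin (nV H) → Fin n) v →
  deg (image H σ) v ≡ sumFin (nV H) (λ y → ind (σ y ≟ v) * deg H y)
deg-image H σ v = begin
  deg (image H σ) v
    ≡⟨ sum-cong (nE H) (λ f → cong₂ _+_ (pick (proj₁ (ends H f))) (pick (proj₂ (ends H f)))) ⟩
  sumFin (nE H) (λ f → sumFin (nV H) (λ y → inFibre y * ind (proj₁ (ends H f) ≟ y))
                     + sumFin (nV H) (λ y → inFibre y * ind (proj₂ (ends H f) ≟ y)))
    ≡⟨ sum-cong (nE H) (λ f → sym (sum-+ (nV H) _ _)) ⟩
  sumFin (nE H) (λ f → sumFin (nV H) (λ y → inFibre y * ind (proj₁ (ends H f) ≟ y)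
                                         + inFibre y * ind (proj₂ (ends H f) ≟ y)))
    ≡⟨ sum-swap (nE H) (nV H) _ ⟩
  sumFin (nV H) (λ y → sumFin (nE H) (λ f → inFibre y * ind (proj₁ (ends H f) ≟ y)
                                         + inFibre y * ind (proj₂ (ends H f) ≟ y)))
    ≡⟨ sum-cong (nV H) (λ y → trans (sum-cong (nE H) (λ f → sym (*-distribˡ-+ (inFibre y) _ _)))
                                    (sum-*ˡ (nE H) (inFibre y) _)) ⟩
  sumFin (nV H) (λ y → inFibre y * deg H y)
    ∎
  where
  open ≡-Reasoning
  inFibre : Fin (nV H) → ℕ
  inFibre y = ind (σ y ≟ v)
  pick : ∀ c → inFibre c ≡ sumFin (nV H) (λ y → inFibre y * ind (c ≟ y))
  pick c = sym (sum-delta (nV H) inFibre c)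

-- If G is the homomorphic image of H by φ, the degree of v in G is the
-- total degree of its fibre φ⁻¹(v) in H.  (HomImage G H φ says precisely that
-- G and 'image H φ' have the same edge multiplicities.)
deg-hom : ∀ G H φ → HomImage G H φ → ∀ v →
  deg G v ≡ sumFin (nV H) (λ y → ind (φ y ≟ v) * deg H y)
deg-hom G H φ (_ , same) v = begin
  deg G v
    ≡⟨ deg-from-multiplicities G v ⟩
  sumFin (nV G) (λ u → edgesBetween G v u) + edgesBetween G v v
    ≡⟨ cong₂ _+_ (sum-cong (nV G) (same v)) (same v v) ⟩
  sumFin (nV G) (λ u → edgesBetween (image H φ) v u) + edgesBetween (image H φ) v v
    ≡⟨ deg-from-multiplicities (image H φ) v ⟨
  deg (image H φ) v
    ≡⟨ deg-image H φ v ⟩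
  sumFin (nV H) (λ y → ind (φ y ≟ v) * deg H y)
    ∎
  where open ≡-Reasoning

fibre-weight : ∀ {m N} (φ : Fin m → Fin N) v k →
  sumFin m (λ y → ind (φ y ≟ v) * k) ≡ k * preimageSize φ v
fibre-weight {m} φ v k = trans (sum-cong m (λ y → *-comm (ind (φ y ≟ v)) k)) (sum-*ˡ m k _)

deg≤k*fibre : ∀ k G H φ → HomImage G H φ → MaxDegAtMost k H → ∀ v →
  deg G v ≤ k * preimageSize φ v
deg≤k*fibre k G H φ hom maxdeg v = begin
  deg G v                                          ≡⟨ deg-hom G H φ hom v ⟩
  sumFin (nV H) (λ y → ind (φ y ≟ v) * deg H y)    ≤⟨ sum-mono (nV H) (λ y → *-monoʳ-≤ (ind (φ y ≟ v)) (maxdeg y)) ⟩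
  sumFin (nV H) (λ y → ind (φ y ≟ v) * k)          ≡⟨ fibre-weight φ v k ⟩
  k * preimageSize φ v                             ∎
  where open ≤-Reasoning

underfull-partner : ∀ k G H φ → HomImage G H φ → ∀ w →
  deg G (φ w) ≤ k * preimageSize φ (φ w) → k < deg H w →
  ∃[ w′ ] φ w′ ≡ φ w × deg H w′ < k
underfull-partner k G H φ hom w room overfull
  with any? (λ w′ → (φ w′ ≟ φ w) ×-dec (deg H w′ <? k))
... | yes found = found
... | no none = ⊥-elim (<-irrefl refl (begin-strict
  k * preimageSize φ v                            ≡⟨ fibre-weight φ v k ⟨
  sumFin (nV H) (λ y → ind (φ y ≟ v) * k)         <⟨ sum-strict (nV H) at-least-k w at-w ⟩
  sumFin (nV H) (λ y → ind (φ y ≟ v) * deg H y)   ≡⟨ deg-hom G H φ hom v ⟨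
  deg G v                                         ≤⟨ room ⟩
  k * preimageSize φ v                            ∎))
  where
  open ≤-Reasoning
  v : Fin (nV G)
  v = φ w
  at-least-k : ∀ y → ind (φ y ≟ v) * k ≤ ind (φ y ≟ v) * deg H y
  at-least-k y with φ y ≟ v
  ... | yes φy≡v = +-monoˡ-≤ 0 (≮⇒≥ (λ y<k → none (y , φy≡v , y<k)))
  ... | no  _    = z≤n
  at-w : ind (φ w ≟ v) * k < ind (φ w ≟ v) * deg H w
  at-w rewrite ind-yes (φ w ≟ v) refl = +-monoˡ-< 0 overfull

reach-image : ∀ {H n} (σ : Fin (nV H) → Fin n) {u v} →
  Reach H u v → Reach (image H σ) (σ u) (σ v)
reach-image σ here      = here
reach-image σ (fwd e r) = fwd e (reach-image σ r)
reach-image σ (bwd e r) = bwd e (reach-image σ r)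

image-connected : ∀ {H n} (σ : Fin (nV H) → Fin n) → Onto σ →
  Connected H → Connected (image H σ)
image-connected σ onto conn u v with onto u | onto v
... | x , refl | y , refl = reach-image σ (conn x y)

hom-factor : ∀ G H {n} (σ : Fin (nV H) → Fin n) φ (ψ : Fin n → Fin (nV G)) →
  (∀ i → ψ (σ i) ≡ φ i) → HomImage G H φ → HomImage G (image H σ) ψ
hom-factor G H σ φ ψ factor (onto , same) = onto′ , same′
  where
  onto′ : Onto ψ
  onto′ v = let (x , φx≡v) = onto v in σ x , trans (factor x) φx≡v
  same′ : ∀ u v → edgesBetween G u v ≡ edgesBetween (image (image H σ) ψ) u v
  same′ u v = trans (same u v) (sum-cong (nE H) λ f →
    cong₂ (λ a b → joins (a , b) u v)
          (sym (factor (proj₁ (ends H f)))) (sym (factor (proj₂ (ends H f)))))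

collapse : ∀ {n} (w w′ : Fin (suc n)) → w ≢ w′ → Fin (suc n) → Fin n
collapse w w′ w≢w′ i with w ≟ i
... | yes _   = punchOut w≢w′
... | no w≢i  = punchOut w≢i

collapse-punchIn : ∀ {n} (w w′ : Fin (suc n)) (w≢w′ : w ≢ w′) j →
  collapse w w′ w≢w′ (punchIn w j) ≡ j
collapse-punchIn w w′ w≢w′ j with w ≟ punchIn w j
... | yes w≡ = ⊥-elim (punchInᵢ≢i w j (sym w≡))
... | no  _  = trans (punchOut-cong w refl) (punchOut-punchIn w)

collapse-factor : ∀ {n N} (φ : Fin (suc n) → Fin N) (w w′ : Fin (suc n)) (w≢w′ : w ≢ w′) →
  φ w′ ≡ φ w → ∀ i → φ (punchIn w (collapse w w′ w≢w′ i)) ≡ φ i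
collapse-factor φ w w′ w≢w′ same i with w ≟ i
... | yes refl = trans (cong φ (punchIn-punchOut w≢w′)) same
... | no  w≢i  = cong φ (punchIn-punchOut w≢i)

two-in-fibre : ∀ {m N} (φ : Fin m → Fin N) v → 1 < preimageSize φ v →
  ∃[ w ] ∃[ w′ ] w ≢ w′ × φ w ≡ v × φ w′ ≡ v
two-in-fibre {m} φ v big =
  let inFibre = λ y → ind (φ y ≟ v)
      (w , w-in) = sum-pos m inFibre (<-trans z<s big)
      φw≡v = ind-pos (φ w ≟ v) w-in
      rest = subst (_< preimageSize φ v) (sym (ind-yes (φ w ≟ v) φw≡v)) big
      (w′ , w′≢w , w′-in) = sum-other m inFibre w rest
  in w , w′ , w′≢w ∘ sym , φw≡v , ind-pos (φ w′ ≟ v) w′-in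

Realises : (G : Graph) → (Fin (nV G) → ℕ) → Set
Realises G μ = ∃[ H ] Connected H × ∃[ φ ] HomImage G H φ × (∀ v → preimageSize φ v ≡ μ v)

-- Forward direction: a connected cover whose fibres are at least μ can be
-- cut down to fibres exactly μ (for positive μ) by collapsing two vertices
-- of an oversized fibre, which keeps the cover connected.  The cover is
-- given by its components so that the recursion can be on its vertex count.
shrink-fibres : ∀ G (μ : Fin (nV G) → ℕ) → (∀ v → 1 ≤ μ v) →
  ∀ n m (p : Fin m → Fin n × Fin n) (φ : Fin n → Fin (nV G)) →
  Connected (mkGraph n m p) → HomImage G (mkGraph n m p) φ →
  (∀ v → μ v ≤ preimageSize φ v) → Realises G μ
shrink-fibres G μ μ-pos n m p φ conn hom μ≤
  with any? (λ v → μ v <? preimageSize φ v)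
... | no none = mkGraph n m p , conn , φ , hom , λ v → ≤-antisym (≮⇒≥ (λ lt → none (v , lt))) (μ≤ v)
shrink-fibres G μ μ-pos zero    m p φ conn hom μ≤ | yes (v , ())
shrink-fibres G μ μ-pos (suc n) m p φ conn hom μ≤ | yes (v , oversized)
  with two-in-fibre φ v (≤-<-trans (μ-pos v) oversized)
... | w , w′ , w≢w′ , refl , φw′≡φw =
  shrink-fibres G μ μ-pos n m (ends (image H σ)) (φ ∘ punchIn w)
    (image-connected σ (λ j → punchIn w j , collapse-punchIn w w′ w≢w′ j) conn)
    (hom-factor G H σ φ (φ ∘ punchIn w) (collapse-factor φ w w′ w≢w′ φw′≡φw) hom)
    μ≤′
  where
  H : Graph
  H = mkGraph (suc n) m p
  σ : Fin (suc n) → Fin n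
  σ = collapse w w′ w≢w′
  μ≤′ : ∀ u → μ u ≤ preimageSize (φ ∘ punchIn w) u
  μ≤′ u with φ w ≟ u | sum-pivot n (λ y → ind (φ y ≟ u)) w
  ... | yes refl | split = +-cancelˡ-≤ 1 _ _ (subst (μ (φ w) <_) split oversized)
  ... | no  _    | split = subst (μ u ≤_) split (μ≤ u)

data Avoiding (H : Graph) (w s : Fin (nV H)) : Fin (nV H) → Set where
  here : Avoiding H w s s
  fwd  : ∀ e → proj₁ (ends H e) ≢ w → proj₂ (ends H e) ≢ w →
         Avoiding H w s (proj₁ (ends H e)) → Avoiding H w s (proj₂ (ends H e))
  bwd  : ∀ e → proj₁ (ends H e) ≢ w → proj₂ (ends H e) ≢ w →
         Avoiding H w s (proj₂ (ends H e)) → Avoiding H w s (proj₁ (ends H e))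

avoiding-≢ : ∀ {H w s y} → s ≢ w → Avoiding H w s y → y ≢ w
avoiding-≢ s≢w here            = s≢w
avoiding-≢ s≢w (fwd e _ b≢w _) = b≢w
avoiding-≢ s≢w (bwd e a≢w _ _) = a≢w

record Entry (H : Graph) (w s : Fin (nV H)) : Set where
  field
    edge   : Fin (nE H)
    from   : Fin (nV H)
    path   : Avoiding H w s from
    from≢w : from ≢ w
    enters : ends H edge ≡ (from , w) ⊎ ends H edge ≡ (w , from)

first-entry : ∀ {H w s y} → s ≢ w → Reach H s y → Avoiding H w s y ⊎ Entry H w s
first-entry s≢w here = inj₁ here
first-entry {H} {w} s≢w (fwd e r) with first-entry s≢w r
... | inj₂ entry = inj₂ entry
... | inj₁ path with proj₂ (ends H e) ≟ w
...   | yes b≡w = inj₂ (record { path = path ; from≢w = avoiding-≢ s≢w path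
                              ; enters = inj₁ (cong (_ ,_) b≡w) })
...   | no  b≢w = inj₁ (fwd e (avoiding-≢ s≢w path) b≢w path)
first-entry {H} {w} s≢w (bwd e r) with first-entry s≢w r
... | inj₂ entry = inj₂ entry
... | inj₁ path with proj₁ (ends H e) ≟ w
...   | yes a≡w = inj₂ (record { path = path ; from≢w = avoiding-≢ s≢w path
                              ; enters = inj₂ (cong (_, _) a≡w) })
...   | no  a≢w = inj₁ (bwd e a≢w (avoiding-≢ s≢w path) path)

-- The entering edge is not a loop, so it contributes exactly one to deg(w).
entry-incidence : ∀ {H w s} (en : Entry H w s) → incidence (ends H (Entry.edge en)) w ≡ 1
entry-incidence {H} {w} en with Entry.enters en
... | inj₁ eq rewrite eq =
  cong₂ _+_ (ind-no (Entry.from en ≟ w) (Entry.from≢w en)) (ind-yes (w ≟ w) refl)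
... | inj₂ eq rewrite eq =
  cong₂ _+_ (ind-yes (w ≟ w) refl) (ind-no (Entry.from en ≟ w) (Entry.from≢w en))

entry : ∀ {H w s} → s ≢ w → Reach H s w → Entry H w s
entry s≢w r with first-entry s≢w r
... | inj₁ path  = ⊥-elim (avoiding-≢ s≢w path refl)
... | inj₂ found = found

moveEnd : ∀ {n} (p : Fin n × Fin n) {w} → EndAt p w → Fin n → Fin n × Fin n
moveEnd p (inj₁ _) w′ = w′ , proj₂ p
moveEnd p (inj₂ _) w′ = proj₁ p , w′

incidence-moveEnd : ∀ {n} (p : Fin n × Fin n) {w} (at : EndAt p w) w′ y →
  incidence (moveEnd p at w′) y + ind (w ≟ y) ≡ incidence p y + ind (w′ ≟ y)
incidence-moveEnd p (inj₁ refl) w′ y = xy∙z≈zy∙x (ind (w′ ≟ y)) (ind (proj₂ p ≟ y)) (ind (proj₁ p ≟ y))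
incidence-moveEnd p (inj₂ refl) w′ y = xy∙z≈xz∙y (ind (proj₁ p ≟ y)) (ind (w′ ≟ y)) (ind (proj₂ p ≟ y))

moveEnd-image : ∀ {n N} (φ : Fin n → Fin N) (p : Fin n × Fin n) {w} (at : EndAt p w) w′ →
  φ w′ ≡ φ w → (φ (proj₁ (moveEnd p at w′)) , φ (proj₂ (moveEnd p at w′))) ≡ (φ (proj₁ p) , φ (proj₂ p))
moveEnd-image φ p (inj₁ refl) w′ same = cong (_, φ (proj₂ p)) same
moveEnd-image φ p (inj₂ refl) w′ same = cong (φ (proj₁ p) ,_) same

moveEnd-reach : ∀ {G s} e (p : Fin (nV G) × Fin (nV G)) {w} (at : EndAt p w) w′ →
  ends G e ≡ moveEnd p at w′ → Reach G s w → Reach G s w′ →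
  Reach G s (proj₁ p) × Reach G s (proj₂ p)
moveEnd-reach e p (inj₁ refl) w′ moved to-w to-w′ = to-w , step-fwd e moved to-w′
moveEnd-reach e p (inj₂ refl) w′ moved to-w to-w′ = step-bwd e moved to-w′ , to-w

module Rewiring (H : Graph) (e : Fin (nE H)) (w w′ : Fin (nV H)) (at-w : EndAt (ends H e) w) where

  newEnds : Fin (nE H) → Fin (nV H) × Fin (nV H)
  newEnds f with f ≟ e
  ... | yes _ = moveEnd (ends H e) at-w w′
  ... | no  _ = ends H f

  rewired : Graph
  rewired = mkGraph (nV H) (nE H) newEnds

  ends-e : newEnds e ≡ moveEnd (ends H e) at-w w′
  ends-e with e ≟ e
  ... | yes _   = refl
  ... | no  e≢e = ⊥-elim (e≢e refl)

  ends-other : ∀ f → f ≢ e → newEnds f ≡ ends H f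
  ends-other f f≢e with f ≟ e
  ... | yes f≡e = ⊥-elim (f≢e f≡e)
  ... | no  _   = refl

  deg-rewired : ∀ y → deg rewired y + ind (w ≟ y) ≡ deg H y + ind (w′ ≟ y)
  deg-rewired y = +-cancelʳ-≡ (g e) _ _ (begin
    deg rewired y + ind (w ≟ y) + g e   ≡⟨ xy∙z≈xz∙y (deg rewired y) _ _ ⟩
    deg rewired y + g e + ind (w ≟ y)   ≡⟨ cong (_+ ind (w ≟ y)) (sum-update (nE H) g g′ e unchanged) ⟩
    deg H y + g′ e + ind (w ≟ y)        ≡⟨ +-assoc (deg H y) _ _ ⟩
    deg H y + (g′ e + ind (w ≟ y))      ≡⟨ cong (deg H y +_) at-e ⟩
    deg H y + (g e + ind (w′ ≟ y))      ≡⟨ x∙yz≈xz∙y (deg H y) _ _ ⟩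
    deg H y + ind (w′ ≟ y) + g e        ∎)
    where
    open ≡-Reasoning
    g g′ : Fin (nE H) → ℕ
    g  f = incidence (ends H f) y
    g′ f = incidence (newEnds f) y
    unchanged : ∀ f → f ≢ e → g′ f ≡ g f
    unchanged f f≢e = cong (λ p → incidence p y) (ends-other f f≢e)
    at-e : g′ e + ind (w ≟ y) ≡ g e + ind (w′ ≟ y)
    at-e = trans (cong (λ p → incidence p y + ind (w ≟ y)) ends-e) (incidence-moveEnd (ends H e) at-w w′ y)

  -- e has an end at w, so paths avoiding w never use it.
  avoids-e : ∀ {f} → proj₁ (ends H f) ≢ w → proj₂ (ends H f) ≢ w → f ≢ e
  avoids-e a≢w b≢w refl = [ a≢w , b≢w ] at-w

  avoiding-survives : ∀ {s y} → Avoiding H w s y → Reach rewired s y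
  avoiding-survives here = here
  avoiding-survives (fwd f a≢w b≢w r) =
    step-fwd {rewired} f (ends-other f (avoids-e a≢w b≢w)) (avoiding-survives r)
  avoiding-survives (bwd f a≢w b≢w r) =
    step-bwd {rewired} f (ends-other f (avoids-e a≢w b≢w)) (avoiding-survives r)

  -- If w′ enters w along an edge other than e, the rewired graph is still
  -- connected: w reaches w′, hence both old ends of e, hence everything.
  rewired-connected : Connected H → (en : Entry H w w′) → Entry.edge en ≢ e → Connected rewired
  rewired-connected conn en edge≢e u v = reach-trans (reach-sym (transfer (conn w u))) (transfer (conn w v))
    where
    open Entry en
    w′⇝w : Reach rewired w′ w
    w′⇝w with enters
    ... | inj₁ eq = step-fwd {rewired} edge (trans (ends-other edge edge≢e) eq) (avoiding-survives path)
    ... | inj₂ eq = step-bwd {rewired} edge (trans (ends-other edge edge≢e) eq) (avoiding-survives path)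
    old-ends : Reach rewired w (proj₁ (ends H e)) × Reach rewired w (proj₂ (ends H e))
    old-ends = moveEnd-reach {rewired} e (ends H e) at-w w′ ends-e here (reach-sym w′⇝w)
    transfer : ∀ {y} → Reach H w y → Reach rewired w y
    transfer here = here
    transfer (fwd f r) with f ≟ e
    ... | yes refl = proj₂ old-ends
    ... | no  f≢e  = step-fwd {rewired} f (ends-other f f≢e) (transfer r)
    transfer (bwd f r) with f ≟ e
    ... | yes refl = proj₁ old-ends
    ... | no  f≢e  = step-bwd {rewired} f (ends-other f f≢e) (transfer r)

  rewired-hom : ∀ G φ → φ w′ ≡ φ w → HomImage G H φ → HomImage G rewired φ
  rewired-hom G φ same (onto , mult) = onto , λ u v →
    trans (mult u v) (sum-cong (nE H) λ f → cong (λ q → joins q u v) (sym (same-image f)))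
    where
    same-image : ∀ f → ends (image rewired φ) f ≡ ends (image H φ) f
    same-image f with f ≟ e
    ... | yes refl = moveEnd-image φ (ends H f) at-w w′ same
    ... | no  _    = refl

excess : ℕ → Graph → ℕ
excess k H = sumFin (nV H) (λ y → deg H y ∸ k)

excess-drops : ∀ n k (d d′ : Fin n → ℕ) w w′ → w′ ≢ w → k < d w → d w′ < k →
  (∀ y → d′ y + ind (w ≟ y) ≡ d y + ind (w′ ≟ y)) →
  sumFin n (λ y → d′ y ∸ k) < sumFin n (λ y → d y ∸ k)
excess-drops n k d d′ w w′ w′≢w over under shift =
  sum-strict n pointwise w (subst (λ x → d′ w ∸ k < x ∸ k) lose (begin-strict
    d′ w ∸ k         <⟨ n<1+n (d′ w ∸ k) ⟩
    suc (d′ w ∸ k)   ≡⟨ +-∸-assoc 1 k≤d′w ⟨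
    suc (d′ w) ∸ k   ∎))
  where
  open ≤-Reasoning
  shift-at : ∀ y {i j} → ind (w ≟ y) ≡ i → ind (w′ ≟ y) ≡ j → d′ y + i ≡ d y + j
  shift-at y p q = trans (cong (d′ y +_) (sym p)) (trans (shift y) (cong (d y +_) q))
  lose : suc (d′ w) ≡ d w
  lose = trans (+-comm 1 (d′ w)) (trans (shift-at w (ind-yes (w ≟ w) refl) (ind-no (w′ ≟ w) w′≢w))
                                        (+-identityʳ (d w)))
  k≤d′w : k ≤ d′ w
  k≤d′w = ≤-pred (subst (k <_) (sym lose) over)
  pointwise : ∀ y → d′ y ∸ k ≤ d y ∸ k
  pointwise y with w ≟ y | w′ ≟ y
  ... | yes refl | _        = ∸-monoˡ-≤ k (subst (d′ w ≤_) lose (n≤1+n (d′ w)))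
  ... | no w≢w′  | yes refl = subst (_≤ d w′ ∸ k) (sym (m≤n⇒m∸n≡0 (subst (_≤ k) (sym gain) under))) z≤n
    where
    gain : d′ w′ ≡ suc (d w′)
    gain = trans (sym (+-identityʳ (d′ w′)))
                 (trans (shift-at w′ (ind-no (w ≟ w′) w≢w′) (ind-yes (w′ ≟ w′) refl)) (+-comm (d w′) 1))
  ... | no w≢y   | no w′≢y  =
    ≤-reflexive (cong (_∸ k) (+-cancelʳ-≡ 0 _ _ (shift-at y (ind-no (w ≟ y) w≢y) (ind-no (w′ ≟ y) w′≢y))))

-- A path from w′ enters w by some edge; since deg(w) > k ≥ 1 there is
-- another edge e at w, and moving its end from w to w′ keeps H connected, keeps
-- G its homomorphic image, and lowers the excess.
rebalance : ∀ k .{{_ : NonZero k}} G H φ → Connected H → HomImage G H φ →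
  ∀ w w′ → k < deg H w → deg H w′ < k → φ w′ ≡ φ w →
  ∃[ p ] Connected (mkGraph (nV H) (nE H) p) × HomImage G (mkGraph (nV H) (nE H) p) φ
         × excess k (mkGraph (nV H) (nE H) p) < excess k H
rebalance k G H φ conn hom w w′ over under same =
  newEnds , rewired-connected conn en (e≢edge ∘ sym) , rewired-hom G φ same hom ,
  excess-drops (nV H) k (deg H) (deg rewired) w w′ w′≢w over under deg-rewired
  where
  w′≢w : w′ ≢ w
  w′≢w refl = <-asym over under
  en : Entry H w w′
  en = entry w′≢w (conn w′ w)
  at-w : Fin (nE H) → ℕ
  at-w f = incidence (ends H f) w
  another : ∃[ e ] e ≢ Entry.edge en × 0 < at-w e
  another = sum-other (nE H) at-w (Entry.edge en)
              (subst (_< deg H w) (sym (entry-incidence en)) (≤-<-trans (>-nonZero⁻¹ k) over))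
  e : Fin (nE H)
  e = proj₁ another
  e≢edge : e ≢ Entry.edge en
  e≢edge = proj₁ (proj₂ another)
  open Rewiring H e w w′ (incidence-pos⁻¹ (ends H e) (proj₂ (proj₂ another)))

-- Backward direction: starting from a connected cover whose fibres satisfy
-- deg(v) ≤ k·|φ⁻¹(v)|, rebalance until no vertex exceeds degree k; the
-- excess bounds the number of steps.
balance : ∀ k .{{_ : NonZero k}} G fuel H → Connected H → ∀ φ → HomImage G H φ →
  (∀ v → deg G v ≤ k * preimageSize φ v) → excess k H < fuel → KTrail k G
balance k G zero       H conn φ hom room ()
balance k G (suc fuel) H conn φ hom room bounded with any? (λ w → k <? deg H w)
... | no none = H , conn , (λ w → ≮⇒≥ (λ over → none (w , over))) , φ , hom
... | yes (w , over) =
  let (w′ , same , under) = underfull-partner k G H φ hom w (room (φ w)) over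
      (p , conn′ , hom′ , drop) = rebalance k G H φ conn hom w w′ over under same
  in balance k G fuel (mkGraph (nV H) (nE H) p) conn′ φ hom′ room (<-≤-trans drop (s≤s⁻¹ bounded))

lemma4 : (k : ℕ) .{{_ : NonZero k}} (G : Graph) → 2 ≤ nV G → Connected G →
    (KTrail k G ⇔ Feasible G (λ v → ceilDiv (deg G v) k))
lemma4 k G two conn = mk⇔ trail⇒feasible feasible⇒trail
  where
  μ : Fin (nV G) → ℕ
  μ v = ceilDiv (deg G v) k
  μ-pos : ∀ v → 1 ≤ μ v
  μ-pos v = ceilDiv-pos (deg G v) k (deg-pos G two conn v)
  trail⇒feasible : KTrail k G → Feasible G μ
  trail⇒feasible (H , connH , maxdeg , φ , hom) =
    μ-pos , shrink-fibres G μ μ-pos (nV H) (nE H) (ends H) φ connH hom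
              (λ v → ceilDiv-least (deg G v) k _ (deg≤k*fibre k G H φ hom maxdeg v))
  feasible⇒trail : Feasible G μ → KTrail k G
  feasible⇒trail (_ , H , connH , φ , hom , sizes) =
    balance k G (suc (excess k H)) H connH φ hom
      (λ v → subst (λ s → deg G v ≤ k * s) (sym (sizes v)) (ceilDiv-covers (deg G v) k)) ≤-refl
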